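{- Let $\ell\geqslant 3$ be an integer and let $p,q$ be positive integers written as $p=(\ell-2)r+e$ and $q=(\ell-2)s+f$ with integers $r,s\geqslant 0$, $1\leqslant e\leqslant \ell-2$ and $1\leqslant f\leqslant \ell-2$. If $r<s$, then $$m(p,q,\ell)=(\ell-1)(p-1)+q.$$
   Context: All graphs are simple. An ordered bipartite graph $(G;A,B)$ is a bipartite graph $G$ whose vertex set is partitioned into independent sets $A$ and $B$, each equipped with a linear order. Two vertices $u<v$ of the same part are consecutive if no vertex $w$ of that part satisfies $u<w<v$. Identifying two consecutive vertices $u,v$ replaces them by a single vertex $w$ (in their place in the order) whose neighbourhood is the union of the neighbourhoods of $u$ and $v$. Two ordered bipartite graphs are isomorphic if there is a graph isomorphism between them that maps parts to parts (possibly exchanging the two parts) and preserves both linear orders. An ordered bipartite graph $H$ is an interval minor of $G$ if a graph isomorphic to $H$ can be obtained from $G$ by repeatedly deleting edges and identifying consecutive vertices; otherwise $G$ is $H$-interval minor free. $ex(p,q,H)$ denotes the maximum number of edges of an ordered bipartite graph with parts of sizes $p$ and $q$ (the first part of size $p$, the second of size $q$) that is $H$-interval minor free, and $m(p,q,\ell)$ denotes $ex(p,q,K_{2,\ell})$, where $K_{2,\ell}$ is the complete bipartite graph with parts of sizes $2$ and $\ell$. -}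

module Defs where

open import Data.Nat using (ℕ; zero; suc; _+_; _*_; _∸_; _≤_; _<_; _<ᵇ_)
open import Data.Bool using (Bool; true; false; if_then_else_; _∨_; _∧_)
open import Data.Fin using (Fin; toℕ; inject₁; _≟_)
import Data.Fin as F
open import Data.List using (List; map; allFin)
open import Data.Nat.ListAction using (sum)
open import Data.Product using (Σ; ∃; _×_; _,_)
open import Data.Sum using (_⊎_)
open import Relation.Nullary using (¬_)
open import Relation.Nullary.Decidable using (⌊_⌋)
open import Relation.Binary.PropositionalEquality using (_≡_)
open import Relation.Binary.Construct.Closure.ReflexiveTransitive using (Star)
open import Function.Bundles using (Bijection; _⤖_)

-- Edge relation of an ordered bipartite graph with first part A = Fin p and
-- second part B = Fin q (each ordered by the natural order of Fin).
Mat : ℕ → ℕ → Set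
Mat p q = Fin p → Fin q → Bool

record OBG : Set where
  constructor obg
  field
    sizeA : ℕ
    sizeB : ℕ
    E     : Mat sizeA sizeB
open OBG public

bool→ℕ : Bool → ℕ
bool→ℕ true  = 1
bool→ℕ false = 0

edges : OBG → ℕ
edges (obg p q E) = sum (map (λ i → sum (map (λ j → bool→ℕ (E i j)) (allFin q))) (allFin p))

deleteEdge : ∀ {p q} → Fin p → Fin q → Mat p q → Mat p q
deleteEdge i0 j0 E i j = if ⌊ i ≟ i0 ⌋ ∧ ⌊ j ≟ j0 ⌋ then false else E i j

-- identify the consecutive vertices inject₁ k and suc k of a part of size suc n;
-- result is a function on Fin n (position k holds the union of the two rows)
identifyRow : ∀ {n} {X : Set} → (X → X → X) → Fin n → (Fin (suc n) → X) → Fin n → X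
identifyRow _⊕_ k g i =
  if toℕ i <ᵇ toℕ k then g (inject₁ i)
  else if toℕ k <ᵇ toℕ i then g (F.suc i)
  else (g (inject₁ i) ⊕ g (F.suc i))

identifyA : ∀ {p q} → Fin p → Mat (suc p) q → Mat p q
identifyA k E i j = identifyRow _∨_ k (λ x → E x j) i

identifyB : ∀ {p q} → Fin q → Mat p (suc q) → Mat p q
identifyB k E i j = identifyRow _∨_ k (λ y → E i y) j

data Step : OBG → OBG → Set where
  del  : ∀ {p q} (E : Mat p q) (i0 : Fin p) (j0 : Fin q) →
         Step (obg p q E) (obg p q (deleteEdge i0 j0 E))
  idA  : ∀ {p q} (E : Mat (suc p) q) (k : Fin p) →
         Step (obg (suc p) q E) (obg p q (identifyA k E))
  idB  : ∀ {p q} (E : Mat p (suc q)) (k : Fin q) →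
         Step (obg p (suc q) E) (obg p q (identifyB k E))

StrictMono : ∀ {m n} → (Fin m → Fin n) → Set
StrictMono f = ∀ {i j} → i F.< j → f i F.< f j

-- isomorphism of ordered bipartite graphs: bijections mapping parts to parts
-- (possibly exchanging them), preserving both orders and adjacency
Iso : OBG → OBG → Set
Iso (obg p q E) (obg p' q' E') =
  (Σ (Fin p ⤖ Fin p') λ σ → Σ (Fin q ⤖ Fin q') λ τ →
     StrictMono (Bijection.to σ) × StrictMono (Bijection.to τ) ×
     (∀ i j → E i j ≡ E' (Bijection.to σ i) (Bijection.to τ j)))
  ⊎
  (Σ (Fin p ⤖ Fin q') λ σ → Σ (Fin q ⤖ Fin p') λ τ →
     StrictMono (Bijection.to σ) × StrictMono (Bijection.to τ) ×
     (∀ i j → E i j ≡ E' (Bijection.to τ j) (Bijection.to σ i)))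

IntervalMinor : OBG → OBG → Set
IntervalMinor H G = Σ OBG λ G' → Star Step G G' × Iso G' H

IMFree : OBG → OBG → Set
IMFree H G = ¬ IntervalMinor H G

IsEx : ℕ → ℕ → OBG → ℕ → Set
IsEx p q H N =
  (Σ (Mat p q) λ E → IMFree H (obg p q E) × edges (obg p q E) ≡ N) ×
  (∀ (E : Mat p q) → IMFree H (obg p q E) → edges (obg p q E) ≤ N)

K : ℕ → ℕ → OBG
K a b = obg a b (λ _ _ → true)

IsM : ℕ → ℕ → ℕ → ℕ → Set
IsM p q ℓ N = IsEx p q (K 2 ℓ) N

-- Upper bound: identifying the first two rows loses exactly their common neighbours. If there
-- were ℓ of them, merging all further rows into the second row and collapsing columns would give
-- K_{2,ℓ}; so in a K_{2,ℓ}-free graph each identification loses at most ℓ − 1 edges, and one row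
-- has at most q.
-- Lower bound: a K_{2,ℓ} interval minor is witnessed in the graph itself (with either part as
-- the rows) by a cut of the rows into two intervals and ℓ consecutive column blocks, each with
-- an entry on both sides of the cut; such a witness pulls back through deletions and
-- identifications. For M = ℓ − 2, a staircase of column intervals has (M + 1)(p − 1) + q edges
-- as soon as p − 1 ≤ M k < q (here k = r + 1), and no witness: no row reaches more than M
-- columns past the start of a later row, and when two rows are more than M apart no column of
-- the earlier one lies right of a column of the later one.

module Submission where

open import Defs
open import Data.Bool using (Bool; true; false; not; if_then_else_; _∨_; _∧_)
open import Data.Bool.Properties using (∨-zeroʳ)
open import Data.Fin using (Fin; zero; suc; toℕ; inject₁)
import Data.Fin as F
open import Data.Fin.Properties using (injective⇒≤; toℕ-inject₁; toℕ-fromℕ; toℕ<n)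
open import Data.List using (map; allFin; tabulate)
open import Data.List.Properties using (map-tabulate)
open import Data.Nat using (ℕ; zero; suc; _+_; _*_; _∸_; _≤_; _<_; _<ᵇ_; z≤n; s≤s; z<s; _<?_; _≤?_; NonZero)
open import Data.Nat.DivMod using (_/_; /-monoˡ-≤; m/n≡1+[m∸n]/n; m<n*o⇒m/o<n; m/n*n≤m; 0/n≡0)
open import Data.Nat.ListAction using (sum)
open import Data.Nat.Properties
open import Data.Product using (Σ; _×_; _,_; proj₁; proj₂; map₁; map₂)
open import Data.Sum using (_⊎_; inj₁; inj₂; [_,_]′)
open import Data.Empty using (⊥-elim)
open import Function using (_∘_; id; flip)
open import Function.Properties.Bijection using () renaming (sym-≡ to Bijection-sym)
open import Function.Bundles using (Bijection; _⤖_)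
open import Function.Construct.Identity using (⤖-id)
open import Relation.Binary.PropositionalEquality using (_≡_; refl; sym; trans; cong; cong₂; subst; module ≡-Reasoning)
open import Relation.Binary.Construct.Closure.ReflexiveTransitive using (Star; ε; _◅_)
open import Data.Nat.Tactic.RingSolver using (solve-∀)
open import Relation.Nullary using (¬_; yes; no; contradiction)
open import Relation.Nullary.Reflects using (ofʸ; ofⁿ)
open import Relation.Nullary.Decidable using (⌊_⌋)
open import Algebra.Properties.CommutativeSemigroup +-commutativeSemigroup using (xy∙z≈xz∙y)
open import Algebra.Properties.CommutativeMonoid.Sum +-0-commutativeMonoid
  using (sum-syntax; sum-cong-≗; ∑-distrib-+; sum-init-last; sum-replicate-zero)
  renaming (sum to ∑)

∑-mono-≤ : ∀ n {f g : Fin n → ℕ} → (∀ i → f i ≤ g i) → ∑ f ≤ ∑ g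
∑-mono-≤ zero    f≤g = z≤n
∑-mono-≤ (suc n) f≤g = +-mono-≤ (f≤g zero) (∑-mono-≤ n (f≤g ∘ suc))

sum-map-allFin : ∀ n (f : Fin n → ℕ) → sum (map f (allFin n)) ≡ ∑ f
sum-map-allFin n f = trans (cong sum (map-tabulate (λ i → i) f)) (sum-tabulate n f)
  where
  sum-tabulate : ∀ n (f : Fin n → ℕ) → sum (tabulate f) ≡ ∑ f
  sum-tabulate zero    f = refl
  sum-tabulate (suc n) f = cong (f zero +_) (sum-tabulate n (f ∘ suc))

∑-toℕ-last : ∀ n (g : ℕ → ℕ) → ∑[ j < suc n ] g (toℕ j) ≡ ∑[ j < n ] g (toℕ j) + g n
∑-toℕ-last n g = trans (sum-init-last (g ∘ toℕ))
  (cong₂ _+_ (sum-cong-≗ {n} {g ∘ toℕ ∘ inject₁} {g ∘ toℕ} (cong g ∘ toℕ-inject₁))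
             (cong g (toℕ-fromℕ n)))

∑-telescope : ∀ (f : ℕ → ℕ) c → (∀ i → f i ≤ f (suc i)) →
  ∀ n → ∑[ i < n ] (f (suc (toℕ i)) + c ∸ f (toℕ i)) + f 0 ≡ c * n + f n
∑-telescope f c f-mono zero    = cong (_+ f 0) (sym (*-zeroʳ c))
∑-telescope f c f-mono (suc n) = begin
  ∑[ i < suc n ] step (toℕ i) + f 0   ≡⟨ cong (_+ f 0) (∑-toℕ-last n step) ⟩
  ∑[ i < n ] step (toℕ i) + step n + f 0
    ≡⟨ trans (xy∙z≈xz∙y (∑[ i < n ] step (toℕ i)) _ _) (cong (_+ step n) (∑-telescope f c f-mono n)) ⟩
  c * n + f n + step n                ≡⟨ +-assoc (c * n) (f n) (step n) ⟩
  c * n + (f n + step n)              ≡⟨ cong (c * n +_) (m+[n∸m]≡n (≤-trans (f-mono n) (m≤m+n _ c))) ⟩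
  c * n + (f (suc n) + c)             ≡⟨ shift c n (f (suc n)) ⟩
  c * suc n + f (suc n)               ∎
  where
  open ≡-Reasoning
  step : ℕ → ℕ
  step i = f (suc i) + c ∸ f i
  shift : ∀ c n x → c * n + (x + c) ≡ c * suc n + x
  shift = solve-∀

count-below : ∀ c n → c ≤ n → ∑[ j < n ] bool→ℕ (toℕ j <ᵇ c) ≡ c
count-below zero    n       _         = sum-replicate-zero n
count-below (suc c) (suc n) (s≤s c≤n) = cong suc (count-below c n c≤n)

inInterval : ℕ → ℕ → ℕ → Bool
inInterval a b j = not (j <ᵇ a) ∧ (j <ᵇ b)

below+inInterval : ∀ {a b} → a ≤ b → ∀ j → bool→ℕ (j <ᵇ a) + bool→ℕ (inInterval a b j) ≡ bool→ℕ (j <ᵇ b)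
below+inInterval {a} {b} a≤b j with j <ᵇ a | <ᵇ-reflects-< j a
... | false | _       = refl
... | true  | ofʸ j<a with j <ᵇ b | <ᵇ-reflects-< j b
...   | true  | _       = refl
...   | false | ofⁿ j≮b = contradiction (<-≤-trans j<a a≤b) j≮b

count-inInterval : ∀ {a b} n → a ≤ b → b ≤ n → ∑[ j < n ] bool→ℕ (inInterval a b (toℕ j)) ≡ b ∸ a
count-inInterval {a} {b} n a≤b b≤n =
  trans (sym (m+n∸m≡n a (∑ inside))) (cong (_∸ a) a+inside≡b)
  where
  open ≡-Reasoning
  below : ℕ → Fin n → ℕ
  below c j = bool→ℕ (toℕ j <ᵇ c)
  inside : Fin n → ℕ
  inside j = bool→ℕ (inInterval a b (toℕ j))
  a+inside≡b : a + ∑ inside ≡ b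
  a+inside≡b = begin
    a + ∑ inside                      ≡⟨ cong (_+ ∑ inside) (count-below a n (≤-trans a≤b b≤n)) ⟨
    ∑ (below a) + ∑ inside            ≡⟨ ∑-distrib-+ (below a) inside ⟨
    ∑[ j < n ] (below a j + inside j) ≡⟨ sum-cong-≗ {n} {λ j → below a j + inside j} {below b}
                                                    (below+inInterval a≤b ∘ toℕ) ⟩
    ∑ (below b)                       ≡⟨ count-below b n b≤n ⟩
    b                                 ∎

inInterval⇒ : ∀ {a b} j → inInterval a b j ≡ true → a ≤ j × j < b
inInterval⇒ {a} {b} j e with j <ᵇ a | <ᵇ-reflects-< j a | j <ᵇ b | <ᵇ-reflects-< j b
inInterval⇒ j () | true  | _        | _    | _
inInterval⇒ j () | false | _        | false | _
inInterval⇒ j e  | false | ofⁿ j≮a | true  | ofʸ j<b = ≮⇒≥ j≮a , j<b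

degree : ∀ {q} → (Fin q → Bool) → ℕ
degree {q} R = ∑[ j < q ] bool→ℕ (R j)

edgeCount : ∀ {p q} → Mat p q → ℕ
edgeCount {p} E = ∑[ i < p ] degree (E i)

edges≡edgeCount : ∀ {p q} (E : Mat p q) → edges (obg p q E) ≡ edgeCount E
edges≡edgeCount {p} {q} E =
  trans (sum-map-allFin p _) (sum-cong-≗ (λ i → sum-map-allFin q (λ j → bool→ℕ (E i j))))

bool→ℕ≤1 : ∀ b → bool→ℕ b ≤ 1
bool→ℕ≤1 true  = ≤-refl
bool→ℕ≤1 false = z≤n

degree≤ : ∀ {q} (R : Fin q → Bool) → degree R ≤ q
degree≤ {zero}  R = z≤n
degree≤ {suc q} R = +-mono-≤ (bool→ℕ≤1 (R zero)) (degree≤ (R ∘ suc))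

common : ∀ {q} → (Fin q → Bool) → (Fin q → Bool) → ℕ
common R R′ = degree (λ j → R j ∧ R′ j)

bool→ℕ-∨-∧ : ∀ x y → bool→ℕ x + bool→ℕ y ≡ bool→ℕ (x ∨ y) + bool→ℕ (x ∧ y)
bool→ℕ-∨-∧ true  true  = refl
bool→ℕ-∨-∧ true  false = refl
bool→ℕ-∨-∧ false true  = refl
bool→ℕ-∨-∧ false false = refl

degree-∨-common : ∀ {q} (R R′ : Fin q → Bool) →
  degree R + degree R′ ≡ degree (λ j → R j ∨ R′ j) + common R R′
degree-∨-common R R′ = trans (sym (∑-distrib-+ (bool→ℕ ∘ R) (bool→ℕ ∘ R′)))
  (trans (sum-cong-≗ (λ j → bool→ℕ-∨-∧ (R j) (R′ j)))
         (∑-distrib-+ (λ j → bool→ℕ (R j ∨ R′ j)) (λ j → bool→ℕ (R j ∧ R′ j))))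

edgeCount-identifyA : ∀ {p q} (E : Mat (suc (suc p)) q) →
  edgeCount E ≡ edgeCount (identifyA zero E) + common (E zero) (E (suc zero))
edgeCount-identifyA E = begin
  d₀ + (d₁ + rest)    ≡⟨ +-assoc d₀ d₁ rest ⟨
  d₀ + d₁ + rest      ≡⟨ cong (_+ rest) (degree-∨-common (E zero) (E (suc zero))) ⟩
  d₀₁ + c + rest      ≡⟨ xy∙z≈xz∙y d₀₁ c rest ⟩
  d₀₁ + rest + c      ∎
  where
  open ≡-Reasoning
  d₀ = degree (E zero)
  d₁ = degree (E (suc zero))
  d₀₁ = degree (identifyA zero E zero)
  c = common (E zero) (E (suc zero))
  rest = edgeCount (λ i → E (suc (suc i)))

_⊆_ : ∀ {q} → (Fin q → Bool) → (Fin q → Bool) → Set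
R ⊆ R′ = ∀ j → R j ≡ true → R′ j ≡ true

bool→ℕ-∧-mono : ∀ {a b a′ b′} → (a ≡ true → a′ ≡ true) → (b ≡ true → b′ ≡ true) →
  bool→ℕ (a ∧ b) ≤ bool→ℕ (a′ ∧ b′)
bool→ℕ-∧-mono {true}  {true}  a⇒a′ b⇒b′ rewrite a⇒a′ refl | b⇒b′ refl = ≤-refl
bool→ℕ-∧-mono {true}  {false} _    _    = z≤n
bool→ℕ-∧-mono {false}         _    _    = z≤n

common-mono : ∀ {q} {R₁ R₁′ R₂ R₂′ : Fin q → Bool} → R₁ ⊆ R₁′ → R₂ ⊆ R₂′ →
  common R₁ R₂ ≤ common R₁′ R₂′
common-mono {q} R₁⊆ R₂⊆ = ∑-mono-≤ q (λ j → bool→ℕ-∧-mono (R₁⊆ j) (R₂⊆ j))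

infix 4 _≈ᴹ_
_≈ᴹ_ : ∀ {p q} → Mat p q → Mat p q → Set
E ≈ᴹ F = ∀ i j → E i j ≡ F i j

AllTrue : ∀ {p q} → Mat p q → Set
AllTrue F = ∀ i j → F i j ≡ true

identifyB-cong : ∀ {p q} (k : Fin q) {E F : Mat p (suc q)} → E ≈ᴹ F → identifyB k E ≈ᴹ identifyB k F
identifyB-cong k {E} {F} E≈F i j with toℕ j <ᵇ toℕ k
... | true  = E≈F i (inject₁ j)
... | false with toℕ k <ᵇ toℕ j
...   | true  = E≈F i (suc j)
...   | false = cong₂ _∨_ (E≈F i (inject₁ j)) (E≈F i (suc j))

-- Targets are only determined up to ≈ᴹ: merging inside a tail of columns does not commute
-- definitionally with putting a fixed column in front.
data ColumnMerges {p : ℕ} : ∀ {q q′} → Mat p q → Mat p q′ → Set where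
  done  : ∀ {q} {E F : Mat p q} → E ≈ᴹ F → ColumnMerges E F
  merge : ∀ {q q′} {E : Mat p (suc q)} {F : Mat p q′} (k : Fin q) →
          ColumnMerges (identifyB k E) F → ColumnMerges E F

ColumnMerges-respˡ : ∀ {p q q′} {E E′ : Mat p q} {F : Mat p q′} →
  E′ ≈ᴹ E → ColumnMerges E F → ColumnMerges E′ F
ColumnMerges-respˡ E′≈E (done E≈F)  = done (λ i j → trans (E′≈E i j) (E≈F i j))
ColumnMerges-respˡ E′≈E (merge k m) = merge k (ColumnMerges-respˡ (identifyB-cong k E′≈E) m)

consColumn : ∀ {p q} → (Fin p → Bool) → Mat p q → Mat p (suc q)
consColumn c E i zero    = c i
consColumn c E i (suc j) = E i j

ColumnMerges-cons : ∀ {p q q′} (c : Fin p → Bool) {E : Mat p q} {F : Mat p q′} →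
  ColumnMerges E F → ColumnMerges (consColumn c E) (consColumn c F)
ColumnMerges-cons c (done E≈F)  = done λ { i zero → refl ; i (suc j) → E≈F i j }
ColumnMerges-cons c (merge k m) = merge (suc k)
  (ColumnMerges-respˡ (λ { i zero → refl ; i (suc j) → refl }) (ColumnMerges-cons c m))

ColumnMerges⇒Star : ∀ {p q q′} {E : Mat p q} {F : Mat p q′} → ColumnMerges E F →
  Σ (Mat p q′) λ F′ → Star Step (obg p q E) (obg p q′ F′) × F′ ≈ᴹ F
ColumnMerges⇒Star {E = E} (done E≈F) = E , ε , E≈F
ColumnMerges⇒Star {E = E} (merge k m) with ColumnMerges⇒Star m
... | F′ , steps , F′≈F = F′ , idB E k ◅ steps , F′≈F

common₀₁ : ∀ {p q} → Mat (suc (suc p)) q → ℕ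
common₀₁ E = common (E zero) (E (suc zero))

first-column-common : ∀ {q} (E : Mat 2 (suc q)) → E zero zero ≡ true → E (suc zero) zero ≡ true →
  1 ≤ common₀₁ E
first-column-common E e₀ e₁ rewrite e₀ | e₁ = s≤s z≤n

common₀₁-tail≤identifyB : ∀ {p q} (E : Mat (suc (suc p)) (suc (suc q))) →
  common₀₁ (λ i j → E i (suc j)) ≤ common₀₁ (identifyB zero E)
common₀₁-tail≤identifyB E = common-mono (tail⊆ zero) (tail⊆ (suc zero))
  where
  tail⊆ : ∀ i → (λ j → E i (suc j)) ⊆ identifyB zero E i
  tail⊆ i zero    e = trans (cong (E i zero ∨_) e) (∨-zeroʳ (E i zero))
  tail⊆ i (suc j) e = e

two-rows-minor : ∀ q ℓ (E : Mat 2 q) → suc ℓ ≤ common₀₁ E →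
  Σ (Mat 2 (suc ℓ)) λ F → ColumnMerges E F × AllTrue F
two-rows-minor zero ℓ E ()
two-rows-minor (suc q) ℓ E ℓ<c with E zero zero in e₀ | E (suc zero) zero in e₁
two-rows-minor (suc q) (suc ℓ) E ℓ<c | true | true
  with two-rows-minor q ℓ (λ i j → E i (suc j)) (≤-pred ℓ<c)
... | F , merges , F-true =
  consColumn (λ i → E i zero) F ,
  ColumnMerges-respˡ (λ { i zero → refl ; i (suc j) → refl }) (ColumnMerges-cons _ merges) ,
  λ { zero zero → e₀ ; (suc zero) zero → e₁ ; i (suc j) → F-true i j }
two-rows-minor (suc zero) zero E _ | true | true =
  E , done (λ _ _ → refl) , λ { zero zero → e₀ ; (suc zero) zero → e₁ }
two-rows-minor (suc (suc q)) zero E _ | true | true =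
  map₂ (map₁ (merge zero)) (two-rows-minor (suc q) zero (identifyB zero E)
    (first-column-common (identifyB zero E)
      (cong (_∨ E zero (suc zero)) e₀) (cong (_∨ E (suc zero) (suc zero)) e₁)))
two-rows-minor (suc zero) ℓ E () | true | false
two-rows-minor (suc zero) ℓ E () | false | _
two-rows-minor (suc (suc q)) ℓ E ℓ<c | true | false =
  map₂ (map₁ (merge zero))
    (two-rows-minor (suc q) ℓ (identifyB zero E) (≤-trans ℓ<c (common₀₁-tail≤identifyB E)))
two-rows-minor (suc (suc q)) ℓ E ℓ<c | false | _ =
  map₂ (map₁ (merge zero))
    (two-rows-minor (suc q) ℓ (identifyB zero E) (≤-trans ℓ<c (common₀₁-tail≤identifyB E)))

minor-◅ : ∀ {H G G′} → Step G G′ → IntervalMinor H G′ → IntervalMinor H G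
minor-◅ step (G″ , steps , iso) = G″ , step ◅ steps , iso

AllTrue⇒K2-iso : ∀ {ℓ} (F : Mat 2 ℓ) → AllTrue F → Iso (obg 2 ℓ F) (K 2 ℓ)
AllTrue⇒K2-iso F F-true = inj₁ (⤖-id _ , ⤖-id _ , id , id , F-true)

common₀₁⇒K2-minor : ∀ p q ℓ (E : Mat (suc (suc p)) q) → suc ℓ ≤ common₀₁ E →
  IntervalMinor (K 2 (suc ℓ)) (obg (suc (suc p)) q E)
common₀₁⇒K2-minor zero q ℓ E ℓ<c with two-rows-minor q ℓ E ℓ<c
... | F , merges , F-true with ColumnMerges⇒Star merges
...   | F′ , steps , F′≈F =
  obg 2 (suc ℓ) F′ , steps , AllTrue⇒K2-iso F′ (λ i j → trans (F′≈F i j) (F-true i j))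
common₀₁⇒K2-minor (suc p) q ℓ E ℓ<c = minor-◅ {K 2 (suc ℓ)} (idA E (suc zero))
  (common₀₁⇒K2-minor p q ℓ (identifyA (suc zero) E)
    (≤-trans ℓ<c (common-mono (λ _ e → e) row₁⊆row₁∪row₂)))
  where
  row₁⊆row₁∪row₂ : E (suc zero) ⊆ identifyA (suc zero) E (suc zero)
  row₁⊆row₁∪row₂ j e = cong (_∨ E (suc (suc zero)) j) e

edgeCount-bound-step : ∀ p q ℓ (E : Mat (suc (suc p)) q) → IMFree (K 2 (suc ℓ)) (obg _ q E) →
  edgeCount (identifyA zero E) ≤ ℓ * p + q → edgeCount E ≤ ℓ * suc p + q
edgeCount-bound-step p q ℓ E free merged-bound with suc ℓ ≤? common₀₁ E
... | yes ℓ<c = ⊥-elim (free (common₀₁⇒K2-minor p q ℓ E ℓ<c))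
... | no  ℓ≮c = begin
  edgeCount E                                  ≡⟨ edgeCount-identifyA E ⟩
  edgeCount (identifyA zero E) + common₀₁ E    ≤⟨ +-mono-≤ merged-bound (≤-pred (≰⇒> ℓ≮c)) ⟩
  (ℓ * p + q) + ℓ                              ≡⟨ shift ℓ p q ⟩
  ℓ * suc p + q                                ∎
  where
  open ≤-Reasoning
  shift : ∀ ℓ p q → (ℓ * p + q) + ℓ ≡ ℓ * suc p + q
  shift = solve-∀

K2-free⇒edgeCount≤ : ∀ p q ℓ (E : Mat p q) → IMFree (K 2 (suc ℓ)) (obg p q E) →
  edgeCount E ≤ ℓ * (p ∸ 1) + q
K2-free⇒edgeCount≤ zero          q ℓ E free = z≤n
K2-free⇒edgeCount≤ (suc zero)    q ℓ E free =
  ≤-trans (≤-reflexive (+-identityʳ _)) (≤-trans (degree≤ (E zero)) (m≤n+m q (ℓ * 0)))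
K2-free⇒edgeCount≤ (suc (suc p)) q ℓ E free = edgeCount-bound-step p q ℓ E free
  (K2-free⇒edgeCount≤ (suc p) q ℓ (identifyA zero E) (free ∘ minor-◅ {K 2 (suc ℓ)} (idA E zero)))

extend : ∀ {n} → (Fin n → Bool) → ℕ → Bool
extend {zero}  f i       = false
extend {suc n} f zero    = f zero
extend {suc n} f (suc i) = extend (f ∘ suc) i

extend-cong : ∀ {n} {f g : Fin n → Bool} → (∀ a → f a ≡ g a) → ∀ i → extend f i ≡ extend g i
extend-cong {zero}  f≡g i       = refl
extend-cong {suc n} f≡g zero    = f≡g zero
extend-cong {suc n} f≡g (suc i) = extend-cong (f≡g ∘ suc) i

extend-mono : ∀ {n} {f g : Fin n → Bool} → f ⊆ g → ∀ i → extend f i ≡ true → extend g i ≡ true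
extend-mono {suc n} f⊆g zero    = f⊆g zero
extend-mono {suc n} f⊆g (suc i) = extend-mono (f⊆g ∘ suc) i

extend-∨ : ∀ {n} (f g : Fin n → Bool) i → extend (λ a → f a ∨ g a) i ≡ extend f i ∨ extend g i
extend-∨ {zero}  f g i       = refl
extend-∨ {suc n} f g zero    = refl
extend-∨ {suc n} f g (suc i) = extend-∨ (f ∘ suc) (g ∘ suc) i

extend-true⇒ : ∀ {n} (f : Fin n → Bool) i → extend f i ≡ true → Σ (Fin n) λ a → toℕ a ≡ i × f a ≡ true
extend-true⇒ {suc n} f zero    e = zero , refl , e
extend-true⇒ {suc n} f (suc i) e with extend-true⇒ (f ∘ suc) i e
... | a , refl , fa = suc a , refl , fa

extend-true : ∀ {n} (f : Fin n → Bool) → (∀ a → f a ≡ true) → ∀ {i} → i < n → extend f i ≡ true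
extend-true {suc n} f f-true {zero}  _          = f-true zero
extend-true {suc n} f f-true {suc i} (s≤s i<n) = extend-true (f ∘ suc) (f-true ∘ suc) i<n

mergeAt : ℕ → (ℕ → Bool) → ℕ → Bool
mergeAt k h i = if i <ᵇ k then h i else if k <ᵇ i then h (suc i) else (h i ∨ h (suc i))

extend-identifyRow : ∀ {n} (k : Fin n) (g : Fin (suc n) → Bool) i →
  extend (identifyRow _∨_ k g) i ≡ mergeAt (toℕ k) (extend g) i
extend-identifyRow {suc n}       zero    g zero    = refl
extend-identifyRow {suc zero}    zero    g (suc i) = refl
extend-identifyRow {suc (suc n)} zero    g (suc i) = refl
extend-identifyRow {suc n}       (suc k) g zero    = refl
extend-identifyRow {suc n}       (suc k) g (suc i) = extend-identifyRow k (g ∘ suc) i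

-- Matrices read as ℕ-indexed (false outside their range), so that identifications become
-- the reindexings mergeAt and need no Fin arithmetic.
⟦_⟧ : ∀ {p q} → Mat p q → ℕ → ℕ → Bool
⟦ E ⟧ i j = extend (λ a → extend (E a) j) i

mergeRows mergeCols : ℕ → (ℕ → ℕ → Bool) → ℕ → ℕ → Bool
mergeRows k M i j = mergeAt k (λ i′ → M i′ j) i
mergeCols k M i j = mergeAt k (M i) j

⟦identifyA⟧ : ∀ {p q} (k : Fin p) (E : Mat (suc p) q) i j →
  ⟦ identifyA k E ⟧ i j ≡ mergeRows (toℕ k) ⟦ E ⟧ i j
⟦identifyA⟧ k E i j =
  trans (extend-cong extend-column i) (extend-identifyRow k (λ a → extend (E a) j) i)
  where
  extend-column : ∀ a → extend (λ j′ → identifyA k E a j′) j ≡ identifyRow _∨_ k (λ x → extend (E x) j) a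
  extend-column a with toℕ a <ᵇ toℕ k
  ... | true  = refl
  ... | false with toℕ k <ᵇ toℕ a
  ...   | true  = refl
  ...   | false = extend-∨ (E (inject₁ a)) (E (suc a)) j

⟦identifyB⟧ : ∀ {p q} (k : Fin q) (E : Mat p (suc q)) i j →
  ⟦ identifyB k E ⟧ i j ≡ mergeCols (toℕ k) ⟦ E ⟧ i j
⟦identifyB⟧ k E i j = trans (extend-cong (λ a → extend-identifyRow k (E a) j) i) extend-mergeAt
  where
  extend-mergeAt : extend (λ a → mergeAt (toℕ k) (extend (E a)) j) i ≡ mergeAt (toℕ k) (⟦ E ⟧ i) j
  extend-mergeAt with j <ᵇ toℕ k
  ... | true  = refl
  ... | false with toℕ k <ᵇ j
  ...   | true  = refl
  ...   | false = extend-∨ (λ a → extend (E a) j) (λ a → extend (E a) (suc j)) i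

-- The position before the merge at K that column c came from, chosen among c and c + 1 so
-- that an entry set after the merge is already set there.
preimage : ℕ → (ℕ → Bool) → ℕ → ℕ
preimage K h c = if c <ᵇ K then c else if K <ᵇ c then suc c else if h c then c else suc c

preimage-true : ∀ K h c → mergeAt K h c ≡ true → h (preimage K h c) ≡ true
preimage-true K h c e with c <ᵇ K
... | true  = e
... | false with K <ᵇ c
...   | true  = e
...   | false with h c in hc
...     | true  = hc
...     | false = e

preimage-≡ : ∀ K h c → preimage K h c ≡ c ⊎ preimage K h c ≡ suc c
preimage-≡ K h c with c <ᵇ K
... | true  = inj₁ refl
... | false with K <ᵇ c
...   | true  = inj₂ refl
...   | false with h c
...     | true  = inj₁ refl
...     | false = inj₂ refl

preimage-≥ : ∀ K h c → c ≤ preimage K h c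
preimage-≥ K h c =
  [ ≤-reflexive ∘ sym , (λ e → ≤-trans (n≤1+n c) (≤-reflexive (sym e))) ]′ (preimage-≡ K h c)

preimage-≤ : ∀ K h c → preimage K h c ≤ suc c
preimage-≤ K h c = [ (λ e → ≤-trans (≤-reflexive e) (n≤1+n c)) , ≤-reflexive ]′ (preimage-≡ K h c)

preimage-below : ∀ K h {c} → c < K → preimage K h c ≡ c
preimage-below K h {c} c<K with c <ᵇ K | <ᵇ-reflects-< c K
... | true  | _        = refl
... | false | ofⁿ c≮K = contradiction c<K c≮K

preimage-above : ∀ K h {c} → K < c → preimage K h c ≡ suc c
preimage-above K h {c} K<c with c <ᵇ K | <ᵇ-reflects-< c K
... | true  | ofʸ c<K = contradiction c<K (<⇒≯ K<c)
... | false | _ with K <ᵇ c | <ᵇ-reflects-< K c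
...   | true  | _        = refl
...   | false | ofⁿ K≮c = contradiction K<c K≮c

preimage-mono : ∀ K h h′ {c c′} → c < c′ → preimage K h c < preimage K h′ c′
preimage-mono K h h′ {c} {c′} c<c′ with c <? K
... | yes c<K = begin-strict
  preimage K h c   ≡⟨ preimage-below K h c<K ⟩
  c                <⟨ c<c′ ⟩
  c′               ≤⟨ preimage-≥ K h′ c′ ⟩
  preimage K h′ c′ ∎
  where open ≤-Reasoning
... | no  c≮K = begin-strict
  preimage K h c    ≤⟨ preimage-≤ K h c ⟩
  suc c             <⟨ s≤s c<c′ ⟩
  suc c′            ≡⟨ preimage-above K h′ (≤-<-trans (≮⇒≥ c≮K) c<c′) ⟨
  preimage K h′ c′  ∎
  where open ≤-Reasoning

data Side : Set where
  upper lower : Side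

OnSide : Side → ℕ → ℕ → Set
OnSide upper cut r = r ≤ cut
OnSide lower cut r = cut < r

-- This is how a K_{2,ℓ} interval minor of M shows up in M itself.
record K2Pattern (ℓ : ℕ) (M : ℕ → ℕ → Bool) : Set where
  field
    cut     : ℕ
    row col : Side → ℕ → ℕ
    on-side : ∀ s {k} → k < ℓ → OnSide s cut (row s k)
    entry   : ∀ s {k} → k < ℓ → M (row s k) (col s k) ≡ true
    ordered : ∀ s s′ {k} → suc k < ℓ → col s k < col s′ (suc k)

  col-lower-0+ : ∀ s {k} → suc k < ℓ → suc k + col lower 0 ≤ col s (suc k)
  col-lower-0+ s {zero}  k<ℓ = ordered lower s k<ℓ
  col-lower-0+ s {suc k} k<ℓ =
    <-≤-trans (s≤s (col-lower-0+ lower (<-trans (n<1+n (suc k)) k<ℓ))) (ordered lower s k<ℓ)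

open K2Pattern

K2Pattern-mono : ∀ {ℓ} {M M′ : ℕ → ℕ → Bool} → (∀ i j → M′ i j ≡ true → M i j ≡ true) →
  K2Pattern ℓ M′ → K2Pattern ℓ M
K2Pattern-mono M′⊆M P = record
  { cut = cut P ; row = row P ; col = col P ; on-side = on-side P ; ordered = ordered P
  ; entry = λ s k<ℓ → M′⊆M _ _ (entry P s k<ℓ)
  }

K2Pattern-resp : ∀ {ℓ} {M M′ : ℕ → ℕ → Bool} → (∀ i j → M i j ≡ M′ i j) →
  K2Pattern ℓ M → K2Pattern ℓ M′
K2Pattern-resp M≡M′ = K2Pattern-mono (λ i j → trans (sym (M≡M′ i j)))

K2Pattern-mergeCols : ∀ {ℓ} K (M : ℕ → ℕ → Bool) → K2Pattern ℓ (mergeCols K M) → K2Pattern ℓ M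
K2Pattern-mergeCols K M P = record
  { cut     = cut P
  ; row     = row P
  ; col     = col′
  ; on-side = on-side P
  ; entry   = λ s k<ℓ → preimage-true K (M (row P s _)) (col P s _) (entry P s k<ℓ)
  ; ordered = λ s s′ {k} k<ℓ →
      preimage-mono K (M (row P s k)) (M (row P s′ (suc k))) (ordered P s s′ k<ℓ)
  }
  where
  col′ : Side → ℕ → ℕ
  col′ s k = preimage K (M (row P s k)) (col P s k)

K2Pattern-mergeRows : ∀ {ℓ} K (M : ℕ → ℕ → Bool) → K2Pattern ℓ (mergeRows K M) → K2Pattern ℓ M
K2Pattern-mergeRows {ℓ} K M P = record
  { cut     = cut′
  ; row     = row′
  ; col     = col P
  ; on-side = on-side′
  ; ordered = ordered P
  ; entry   = λ s {k} k<ℓ → preimage-true K (column s k) (row P s k) (entry P s k<ℓ)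
  }
  where
  column : Side → ℕ → ℕ → Bool
  column s k i = M i (col P s k)
  cut′ : ℕ
  cut′ = if cut P <ᵇ K then cut P else suc (cut P)
  row′ : Side → ℕ → ℕ
  row′ s k = preimage K (column s k) (row P s k)
  on-side′ : ∀ s {k} → k < ℓ → OnSide s cut′ (row′ s k)
  on-side′ s {k} k<ℓ with cut P <ᵇ K | <ᵇ-reflects-< (cut P) K | s | on-side P s k<ℓ
  ... | true  | ofʸ cut<K | upper | r≤cut =
    ≤-trans (≤-reflexive (preimage-below K (column upper k) (≤-<-trans r≤cut cut<K))) r≤cut
  ... | false | _         | upper | r≤cut = ≤-trans (preimage-≤ K (column upper k) _) (s≤s r≤cut)
  ... | true  | _         | lower | cut<r = <-≤-trans cut<r (preimage-≥ K (column lower k) _)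
  ... | false | ofⁿ cut≮K | lower | cut<r = <-≤-trans (s≤s cut<r)
    (≤-reflexive (sym (preimage-above K (column lower k) (≤-<-trans (≮⇒≥ cut≮K) cut<r))))

HasK2Pattern : ℕ → OBG → Set
HasK2Pattern ℓ (obg p q E) = K2Pattern ℓ ⟦ E ⟧ ⊎ K2Pattern ℓ (flip ⟦ E ⟧)

deleteEdge-⊆ : ∀ {p q} (i₀ : Fin p) (j₀ : Fin q) (E : Mat p q) i → deleteEdge i₀ j₀ E i ⊆ E i
deleteEdge-⊆ i₀ j₀ E i j e with ⌊ i F.≟ i₀ ⌋ ∧ ⌊ j F.≟ j₀ ⌋
... | false = e

⟦deleteEdge⟧-⊆ : ∀ {p q} (i₀ : Fin p) (j₀ : Fin q) (E : Mat p q) i j →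
  ⟦ deleteEdge i₀ j₀ E ⟧ i j ≡ true → ⟦ E ⟧ i j ≡ true
⟦deleteEdge⟧-⊆ i₀ j₀ E i j = extend-mono (λ a → extend-mono (deleteEdge-⊆ i₀ j₀ E a) j) i

HasK2Pattern-step : ∀ {ℓ G G′} → Step G G′ → HasK2Pattern ℓ G′ → HasK2Pattern ℓ G
HasK2Pattern-step (del E i₀ j₀) (inj₁ P) = inj₁ (K2Pattern-mono (⟦deleteEdge⟧-⊆ i₀ j₀ E) P)
HasK2Pattern-step (del E i₀ j₀) (inj₂ P) = inj₂ (K2Pattern-mono (flip (⟦deleteEdge⟧-⊆ i₀ j₀ E)) P)
HasK2Pattern-step (idA E k) (inj₁ P) =
  inj₁ (K2Pattern-mergeRows (toℕ k) ⟦ E ⟧ (K2Pattern-resp (⟦identifyA⟧ k E) P))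
HasK2Pattern-step (idA E k) (inj₂ P) =
  inj₂ (K2Pattern-mergeCols (toℕ k) (flip ⟦ E ⟧) (K2Pattern-resp (flip (⟦identifyA⟧ k E)) P))
HasK2Pattern-step (idB E k) (inj₁ P) =
  inj₁ (K2Pattern-mergeCols (toℕ k) ⟦ E ⟧ (K2Pattern-resp (⟦identifyB⟧ k E) P))
HasK2Pattern-step (idB E k) (inj₂ P) =
  inj₂ (K2Pattern-mergeRows (toℕ k) (flip ⟦ E ⟧) (K2Pattern-resp (flip (⟦identifyB⟧ k E)) P))

HasK2Pattern-steps : ∀ {ℓ G G′} → Star Step G G′ → HasK2Pattern ℓ G′ → HasK2Pattern ℓ G
HasK2Pattern-steps ε              P = P
HasK2Pattern-steps (step ◅ steps) P = HasK2Pattern-step step (HasK2Pattern-steps steps P)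

full-K2Pattern : ∀ ℓ (M : ℕ → ℕ → Bool) → (∀ {i j} → i < 2 → j < ℓ → M i j ≡ true) → K2Pattern ℓ M
full-K2Pattern ℓ M M-true = record
  { cut     = 0
  ; row     = λ { upper _ → 0 ; lower _ → 1 }
  ; col     = λ _ k → k
  ; on-side = λ { upper _ → z≤n ; lower _ → s≤s z≤n }
  ; entry   = λ { upper k<ℓ → M-true (s≤s z≤n) k<ℓ ; lower k<ℓ → M-true ≤-refl k<ℓ }
  ; ordered = λ _ _ _ → n<1+n _
  }

⟦⟧-AllTrue : ∀ {p q} (E : Mat p q) → AllTrue E → ∀ {i j} → i < p → j < q → ⟦ E ⟧ i j ≡ true
⟦⟧-AllTrue E E-true {i} {j} i<p j<q =
  extend-true (λ a → extend (E a) j) (λ a → extend-true (E a) (E-true a) j<q) i<p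

bijection⇒≥ : ∀ {m n} → Fin m ⤖ Fin n → n ≤ m
bijection⇒≥ σ = injective⇒≤ (Bijection.injective (Bijection-sym σ))

K2-iso⇒HasK2Pattern : ∀ {ℓ} G → Iso G (K 2 ℓ) → HasK2Pattern ℓ G
K2-iso⇒HasK2Pattern {ℓ} (obg p q E) (inj₁ (σ , τ , _ , _ , E-true)) =
  inj₁ (full-K2Pattern ℓ ⟦ E ⟧ λ i<2 j<ℓ →
    ⟦⟧-AllTrue E E-true (≤-trans i<2 (bijection⇒≥ σ)) (≤-trans j<ℓ (bijection⇒≥ τ)))
K2-iso⇒HasK2Pattern {ℓ} (obg p q E) (inj₂ (σ , τ , _ , _ , E-true)) =
  inj₂ (full-K2Pattern ℓ (flip ⟦ E ⟧) λ i<2 j<ℓ →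
    ⟦⟧-AllTrue E E-true (≤-trans j<ℓ (bijection⇒≥ σ)) (≤-trans i<2 (bijection⇒≥ τ)))

K2-minor⇒HasK2Pattern : ∀ {ℓ} G → IntervalMinor (K 2 ℓ) G → HasK2Pattern ℓ G
K2-minor⇒HasK2Pattern G (G′ , steps , iso) = HasK2Pattern-steps steps (K2-iso⇒HasK2Pattern G′ iso)

-- Row i is the half-open interval [lo i, hi i) of columns; the last row p runs up to q.
module Staircase (M : ℕ) .{{_ : NonZero M}} (p q : ℕ) where

  lo : ℕ → ℕ
  lo i = M * ((i ∸ 1) / M)

  hi : ℕ → ℕ
  hi i = if i <ᵇ p then lo (suc i) + suc M else q

  staircase : Mat (suc p) q
  staircase i j = inInterval (lo (toℕ i)) (hi (toℕ i)) (toℕ j)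

  lo-mono : ∀ {i i′} → i ≤ i′ → lo i ≤ lo i′
  lo-mono i≤i′ = *-monoʳ-≤ M (/-monoˡ-≤ M (∸-monoˡ-≤ 1 i≤i′))

  lo-jump : ∀ {i i′} → suc M + i ≤ i′ → lo (suc i) + M ≤ lo i′
  lo-jump {i} i+M<i′ = ≤-trans (≤-reflexive lo-shift) (lo-mono i+M<i′)
    where
    open ≡-Reasoning
    lo-shift : lo (suc i) + M ≡ lo (suc M + i)
    lo-shift = begin
      M * (i / M) + M        ≡⟨ +-comm _ M ⟩
      M + M * (i / M)        ≡⟨ *-suc M (i / M) ⟨
      M * suc (i / M)        ≡⟨ cong (λ c → M * suc (c / M)) (m+n∸m≡n M i) ⟨
      M * suc ((M + i ∸ M) / M) ≡⟨ cong (M *_) (m/n≡1+[m∸n]/n (m≤m+n M i)) ⟨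
      M * ((M + i) / M)      ∎

  hi-inner : ∀ {i} → i < p → hi i ≡ lo (suc i) + suc M
  hi-inner {i} i<p with i <ᵇ p | <ᵇ-reflects-< i p
  ... | true  | _        = refl
  ... | false | ofⁿ i≮p = contradiction i<p i≮p

  hi-last : hi p ≡ q
  hi-last with p <ᵇ p | <ᵇ-reflects-< p p
  ... | true  | ofʸ p<p = contradiction p<p (<-irrefl refl)
  ... | false | _        = refl

  entry-bounds : ∀ i j → ⟦ staircase ⟧ i j ≡ true → i ≤ p × lo i ≤ j × j < hi i
  entry-bounds i j e with extend-true⇒ (λ a → extend (staircase a) j) i e
  ... | a , refl , e′ with extend-true⇒ (staircase a) j e′
  ...   | b , refl , e″ = ≤-pred (toℕ<n a) , inInterval⇒ (toℕ b) e″

  no-row-pattern : ¬ K2Pattern (suc (suc M)) ⟦ staircase ⟧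
  no-row-pattern P = <-irrefl refl (begin-strict
    x                  <⟨ x<hi ⟩
    hi r               ≡⟨ hi-inner (<-≤-trans r<r′ r′≤p) ⟩
    lo (suc r) + suc M ≤⟨ +-monoˡ-≤ (suc M) (lo-mono r<r′) ⟩
    lo r′ + suc M      ≤⟨ +-monoˡ-≤ (suc M) lo≤y ⟩
    y + suc M          ≡⟨ +-comm y (suc M) ⟩
    suc M + y          ≤⟨ col-lower-0+ P upper ≤-refl ⟩
    x                  ∎)
    where
    open ≤-Reasoning
    x = col P upper (suc M)
    r = row P upper (suc M)
    y = col P lower 0
    r′ = row P lower 0
    r<r′ : r < r′
    r<r′ = ≤-<-trans (on-side P upper ≤-refl) (on-side P lower (s≤s z≤n))
    x<hi : x < hi r
    x<hi = proj₂ (proj₂ (entry-bounds r x (entry P upper ≤-refl)))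
    r′≤p : r′ ≤ p
    r′≤p = proj₁ (entry-bounds r′ y (entry P lower (s≤s z≤n)))
    lo≤y : lo r′ ≤ y
    lo≤y = proj₁ (proj₂ (entry-bounds r′ y (entry P lower (s≤s z≤n))))

  no-column-pattern : ¬ K2Pattern (suc (suc M)) (flip ⟦ staircase ⟧)
  no-column-pattern P = <-irrefl refl (begin-strict
    cut P              <⟨ on-side P lower (s≤s z≤n) ⟩
    c′                 ≤⟨ ≤-pred (≤-trans c′<hi (≤-reflexive (trans (hi-inner y<p) (+-suc _ M)))) ⟩
    lo (suc y) + M     ≤⟨ lo-jump y+M<x ⟩
    lo x               ≤⟨ proj₁ (proj₂ (entry-bounds x c (entry P upper ≤-refl))) ⟩
    c                  ≤⟨ on-side P upper ≤-refl ⟩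
    cut P              ∎)
    where
    open ≤-Reasoning
    x = col P upper (suc M)
    c = row P upper (suc M)
    y = col P lower 0
    c′ = row P lower 0
    y+M<x : suc M + y ≤ x
    y+M<x = col-lower-0+ P upper ≤-refl
    y<p : y < p
    y<p = <-≤-trans (<-≤-trans (m<n+m y z<s) y+M<x) (proj₁ (entry-bounds x c (entry P upper ≤-refl)))
    c′<hi : c′ < hi y
    c′<hi = proj₂ (proj₂ (entry-bounds y c′ (entry P lower (s≤s z≤n))))

  no-K2-pattern : ¬ HasK2Pattern (suc (suc M)) (obg (suc p) q staircase)
  no-K2-pattern (inj₁ P) = no-row-pattern P
  no-K2-pattern (inj₂ P) = no-column-pattern P

  module _ (k : ℕ) (p≤Mk : p ≤ M * k) (Mk<q : M * k < q) where

    hi≤q : ∀ {i} → i ≤ p → hi i ≤ q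
    hi≤q {i} i≤p with i <? p
    ... | yes i<p = begin
      hi i                   ≡⟨ trans (hi-inner i<p) (+-suc _ M) ⟩
      suc (M * (i / M) + M)  ≡⟨ cong suc (trans (+-comm _ M) (sym (*-suc M (i / M)))) ⟩
      suc (M * suc (i / M))  ≤⟨ s≤s (*-monoʳ-≤ M i/M<k) ⟩
      suc (M * k)            ≤⟨ Mk<q ⟩
      q                      ∎
      where
      open ≤-Reasoning
      i/M<k : i / M < k
      i/M<k = m<n*o⇒m/o<n (<-≤-trans i<p (≤-trans p≤Mk (≤-reflexive (*-comm M k))))
    ... | no  i≮p = ≤-reflexive (trans (cong hi (≤-antisym i≤p (≮⇒≥ i≮p))) hi-last)

    lo≤hi : ∀ {i} → i ≤ p → lo i ≤ hi i
    lo≤hi {i} i≤p with i <? p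
    ... | yes i<p =
      ≤-trans (lo-mono (n≤1+n i)) (≤-trans (m≤m+n _ (suc M)) (≤-reflexive (sym (hi-inner i<p))))
    ... | no  i≮p rewrite ≤-antisym i≤p (≮⇒≥ i≮p) = begin
      lo p           ≤⟨ lo-mono (n≤1+n p) ⟩
      M * (p / M)    ≡⟨ *-comm M (p / M) ⟩
      p / M * M      ≤⟨ m/n*n≤m p M ⟩
      p              ≤⟨ p≤Mk ⟩
      M * k          ≤⟨ <⇒≤ Mk<q ⟩
      q              ≡⟨ hi-last ⟨
      hi p           ∎
      where open ≤-Reasoning

    degree-staircase : ∀ i → degree (staircase i) ≡ hi (toℕ i) ∸ lo (toℕ i)
    degree-staircase i = count-inInterval q (lo≤hi i≤p) (hi≤q i≤p)
      where i≤p = ≤-pred (toℕ<n i)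

    edgeCount-staircase : edgeCount staircase ≡ suc M * p + q
    edgeCount-staircase = begin
      edgeCount staircase
        ≡⟨ sum-cong-≗ {suc p} {degree ∘ staircase} {len ∘ toℕ} degree-staircase ⟩
      ∑[ i < suc p ] len (toℕ i)           ≡⟨ ∑-toℕ-last p len ⟩
      ∑[ i < p ] len (toℕ i) + len p       ≡⟨ cong (_+ len p) inner-rows ⟩
      ∑[ i < p ] step (toℕ i) + len p      ≡⟨ cong (_+ len p) telescope ⟩
      suc M * p + lo p + len p             ≡⟨ +-assoc (suc M * p) (lo p) (len p) ⟩
      suc M * p + (lo p + (hi p ∸ lo p))   ≡⟨ cong (suc M * p +_) (m+[n∸m]≡n (lo≤hi ≤-refl)) ⟩
      suc M * p + hi p                     ≡⟨ cong (suc M * p +_) hi-last ⟩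
      suc M * p + q                        ∎
      where
      open ≡-Reasoning
      len step : ℕ → ℕ
      len i = hi i ∸ lo i
      step i = lo (suc i) + suc M ∸ lo i
      inner-rows : ∑[ i < p ] len (toℕ i) ≡ ∑[ i < p ] step (toℕ i)
      inner-rows = sum-cong-≗ {p} {len ∘ toℕ} {step ∘ toℕ}
        (λ i → cong (_∸ lo (toℕ i)) (hi-inner (toℕ<n i)))
      lo-zero : lo 0 ≡ 0
      lo-zero = trans (cong (M *_) (0/n≡0 M)) (*-zeroʳ M)
      telescope : ∑[ i < p ] step (toℕ i) ≡ suc M * p + lo p
      telescope = trans (sym (trans (cong (∑[ i < p ] step (toℕ i) +_) lo-zero) (+-identityʳ _)))
        (∑-telescope lo (suc M) (λ i → lo-mono (n≤1+n i)) p)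

staircase-extremal : ∀ M .{{_ : NonZero M}} p q k → p ≤ M * k → M * k < q →
  IsM (suc p) q (suc (suc M)) (suc M * p + q)
staircase-extremal M p q k p≤Mk Mk<q =
  (staircase , K2-free , trans (edges≡edgeCount staircase) (edgeCount-staircase k p≤Mk Mk<q)) ,
  λ E free → subst (_≤ suc M * p + q) (sym (edges≡edgeCount E))
                    (K2-free⇒edgeCount≤ (suc p) q (suc M) E free)
  where
  open Staircase M p q
  K2-free : IMFree (K 2 (suc (suc M))) (obg (suc p) q staircase)
  K2-free minor = no-K2-pattern (K2-minor⇒HasK2Pattern _ minor)

theorem2p3 : (ℓ p q r s e f : ℕ) → 3 ≤ ℓ →
    p ≡ (ℓ ∸ 2) * r + e → q ≡ (ℓ ∸ 2) * s + f →
    1 ≤ e → e ≤ ℓ ∸ 2 → 1 ≤ f → f ≤ ℓ ∸ 2 →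
    r < s →
    IsM p q ℓ ((ℓ ∸ 1) * (p ∸ 1) + q)
theorem2p3 (suc (suc (suc m))) zero q r s e f (s≤s (s≤s (s≤s z≤n))) p≡ _ 1≤e _ _ _ _
  with () ← ≤-trans 1≤e (≤-trans (m≤n+m e _) (≤-reflexive (sym p≡)))
theorem2p3 (suc (suc (suc m))) (suc p) q r s e f (s≤s (s≤s (s≤s z≤n))) p≡ q≡ _ e≤M 1≤f _ r<s =
  staircase-extremal M p q (suc r) p≤M[r+1] M[r+1]<q
  where
  M = suc m
  p≤M[r+1] : p ≤ M * suc r
  p≤M[r+1] = begin
    p           ≤⟨ n≤1+n p ⟩
    suc p       ≡⟨ p≡ ⟩
    M * r + e   ≤⟨ +-monoʳ-≤ (M * r) e≤M ⟩
    M * r + M   ≡⟨ trans (+-comm (M * r) M) (sym (*-suc M r)) ⟩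
    M * suc r   ∎
    where open ≤-Reasoning
  M[r+1]<q : M * suc r < q
  M[r+1]<q = begin-strict
    M * suc r   ≤⟨ *-monoʳ-≤ M r<s ⟩
    M * s       <⟨ m<m+n (M * s) 1≤f ⟩
    M * s + f   ≡⟨ q≡ ⟨
    q           ∎
    where open ≤-Reasoning
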